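{- Let $R=(r_1,\ldots,r_m)$ and $S=(s_1,\ldots,s_n)$ be sequences of nonnegative integers. Then for all $A\in\mathcal{A}(R,S)$, \[\nu(A)+\nu(\overline{A})=\binom{r_1+\cdots+r_m}{2}-\sum_{i=1}^m\binom{r_i}{2}-\sum_{j=1}^n\binom{s_j}{2}.\]
   Context: $\mathcal{A}(R,S)$ is the class of all $m\times n$ matrices with entries in $\{0,1\}$ whose $i$-th row sums to $r_i$ and $j$-th column sums to $s_j$. An inversion in a $(0,1)$-matrix $A=[a_{ij}]$ is an unordered pair of entries $a_{ij},a_{k\ell}$ with $a_{ij}=a_{k\ell}=1$ and $(i-k)(j-\ell)<0$; $\nu(A)$ denotes the number of inversions of $A$. The conjugate $\overline{A}=[b_{ij}]$ of an $m\times n$ matrix $A$ is the $m\times n$ matrix with $b_{ij}=a_{i,n-j+1}$ (left/right flip). -}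

module Defs where

open import Data.Nat using (ℕ; zero; suc; _+_; _<ᵇ_)
open import Data.Bool using (Bool; true; false; _∧_; if_then_else_)
open import Data.Fin using (Fin; toℕ)
import Data.Fin as F
open import Relation.Binary.PropositionalEquality using (_≡_)

∑ : (n : ℕ) → (Fin n → ℕ) → ℕ
∑ zero    f = 0
∑ (suc n) f = f F.zero + ∑ n (λ i → f (F.suc i))

Matrix01 : ℕ → ℕ → Set
Matrix01 m n = Fin m → Fin n → Bool

bit : Bool → ℕ
bit true  = 1
bit false = 0

rowSum : ∀ {m n} → Matrix01 m n → Fin m → ℕ
rowSum {m} {n} A i = ∑ n (λ j → bit (A i j))

colSum : ∀ {m n} → Matrix01 m n → Fin n → ℕ
colSum {m} {n} A j = ∑ m (λ i → bit (A i j))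

InClass : ∀ {m n} → (Fin m → ℕ) → (Fin n → ℕ) → Matrix01 m n → Set
InClass {m} {n} R S A = (∀ i → rowSum A i ≡ R i) × (∀ j → colSum A j ≡ S j)
  where open import Data.Product using (_×_)

-- number of inversions: unordered pairs of 1-entries (i,j),(k,l) with
-- (i-k)(j-l) < 0.  Each such unordered pair is counted exactly once as
-- the ordered pair with i < k and l < j.
ν : ∀ {m n} → Matrix01 m n → ℕ
ν {m} {n} A =
  ∑ m λ i → ∑ n λ j → ∑ m λ k → ∑ n λ l →
    bit (A i j ∧ A k l ∧ (toℕ i <ᵇ toℕ k) ∧ (toℕ l <ᵇ toℕ j))

-- conjugate: left/right flip, b_ij = a_{i,n-j+1}
conj : ∀ {m n} → Matrix01 m n → Matrix01 m n
conj A i j = A i (F.opposite j)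

{-# OPTIONS --safe #-}
module Submission where

-- Order each pair of ones in distinct rows by row. Its columns then decrease (an inversion of A),
-- increase (an inversion of conj A, since reversing the columns reverses their order) or coincide.
-- There are e₂(R) = ∑_{i<k} rᵢ r_k pairs in all and ∑ⱼ e₂(column j) with equal columns, and
-- C(∑ x, 2) = ∑ C(xᵢ, 2) + e₂(x) evaluates both, the second with C(0, 2) = C(1, 2) = 0.

open import Defs
open import Data.Nat using (ℕ) renaming (_+_ to _+ℕ_)
open import Data.Nat.Combinatorics using (_C_)
open import Data.Fin using (Fin)
open import Data.Integer using (ℤ; +_; _-_)
open import Relation.Binary.PropositionalEquality using (_≡_)

import Algebra.Properties.Semiring.Sum as SemiringSum
open import Data.Bool using (Bool; true; false; _∧_)
open import Data.Bool.Properties using (∧-identityʳ)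
open import Data.Fin using (zero; suc; toℕ; opposite)
open import Data.Fin.Permutation using (reverse)
open import Data.Fin.Properties using (opposite-prop; toℕ≤pred[n])
open import Data.Nat using (zero; suc; _*_; _∸_; _≤_; _<_; s≤s; _<ᵇ_; _≡ᵇ_)
open import Data.Nat.Combinatorics using (nCk+nC[k+1]≡[n+1]C[k+1]; nC1≡n)
open import Data.Nat.Properties
  using (+-*-semiring; +-identityʳ; +-comm; *-identityʳ; *-zeroʳ; ≤-refl; m≤n⇒m≤1+n; m∸n≤m; m≤n+m; m+n∸n≡m)
open import Data.Nat.Tactic.RingSolver using (solve-∀)
import Data.Integer.Properties as ℤ
open import Data.Product using (_,_)
open import Function using (flip)
open import Relation.Binary.PropositionalEquality using (refl; sym; trans; cong; cong₂; module ≡-Reasoning)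

open ≡-Reasoning

private
  module Sum = SemiringSum +-*-semiring

∑≡sum : ∀ n (f : Fin n → ℕ) → ∑ n f ≡ Sum.sum f
∑≡sum zero    f = refl
∑≡sum (suc n) f = cong (f zero +ℕ_) (∑≡sum n (λ i → f (suc i)))

∑-via-sum : ∀ {m n} (f : Fin m → ℕ) (g : Fin n → ℕ) → Sum.sum f ≡ Sum.sum g → ∑ m f ≡ ∑ n g
∑-via-sum {m} {n} f g eq = trans (∑≡sum m f) (trans eq (sym (∑≡sum n g)))

∑-cong : ∀ {n} {f g : Fin n → ℕ} → (∀ i → f i ≡ g i) → ∑ n f ≡ ∑ n g
∑-cong {f = f} {g} f≗g = ∑-via-sum f g (Sum.sum-cong-≗ f≗g)

∑-zero : ∀ n → ∑ n (λ _ → 0) ≡ 0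
∑-zero n = trans (∑≡sum n (λ _ → 0)) (Sum.sum-replicate-zero n)

∑-distrib-+ : ∀ {n} (f g : Fin n → ℕ) → ∑ n (λ i → f i +ℕ g i) ≡ ∑ n f +ℕ ∑ n g
∑-distrib-+ {n} f g = begin
  ∑ n (λ i → f i +ℕ g i)      ≡⟨ ∑≡sum n (λ i → f i +ℕ g i) ⟩
  Sum.sum (λ i → f i +ℕ g i)  ≡⟨ Sum.∑-distrib-+ f g ⟩
  Sum.sum f +ℕ Sum.sum g      ≡⟨ sym (cong₂ _+ℕ_ (∑≡sum n f) (∑≡sum n g)) ⟩
  ∑ n f +ℕ ∑ n g              ∎

∑-comm : ∀ {m n} (f : Fin m → Fin n → ℕ) →
  ∑ m (λ i → ∑ n (f i)) ≡ ∑ n (λ j → ∑ m (λ i → f i j))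
∑-comm {m} {n} f = ∑-via-sum (λ i → ∑ n (f i)) (λ j → ∑ m (λ i → f i j)) (begin
  Sum.sum (λ i → ∑ n (f i))                 ≡⟨ Sum.sum-cong-≗ (λ i → ∑≡sum n (f i)) ⟩
  Sum.sum (λ i → Sum.sum (f i))             ≡⟨ Sum.∑-comm f ⟩
  Sum.sum (λ j → Sum.sum (λ i → f i j))     ≡⟨ Sum.sum-cong-≗ (λ j → sym (∑≡sum m (λ i → f i j))) ⟩
  Sum.sum (λ j → ∑ m (λ i → f i j))         ∎)

∑-reverse : ∀ {n} (f : Fin n → ℕ) → ∑ n f ≡ ∑ n (λ i → f (opposite i))
∑-reverse f = ∑-via-sum f (λ i → f (opposite i)) (Sum.∑-permute f reverse)

*-distribˡ-∑ : ∀ {n} x (f : Fin n → ℕ) → x * ∑ n f ≡ ∑ n (λ i → x * f i)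
*-distribˡ-∑ {n} x f =
  trans (cong (x *_) (∑≡sum n f)) (trans (Sum.*-distribˡ-sum x f) (sym (∑≡sum n (λ i → x * f i))))

*-distribʳ-∑ : ∀ {n} x (f : Fin n → ℕ) → ∑ n f * x ≡ ∑ n (λ i → f i * x)
*-distribʳ-∑ {n} x f =
  trans (cong (_* x) (∑≡sum n f)) (trans (Sum.*-distribʳ-sum x f) (sym (∑≡sum n (λ i → f i * x))))

∑-*-∑ : ∀ {m n} (f : Fin m → ℕ) (g : Fin n → ℕ) → ∑ m f * ∑ n g ≡ ∑ m (λ i → ∑ n (λ j → f i * g j))
∑-*-∑ {n = n} f g = trans (*-distribʳ-∑ (∑ n g) f) (∑-cong (λ i → *-distribˡ-∑ (f i) g))

∑-δ : ∀ {n} (j : Fin n) (f : Fin n → ℕ) → ∑ n (λ l → f l * bit (toℕ j ≡ᵇ toℕ l)) ≡ f j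
∑-δ {suc n} zero f = begin
  f zero * 1 +ℕ ∑ n (λ l → f (suc l) * 0)
    ≡⟨ cong₂ _+ℕ_ (*-identityʳ (f zero)) (trans (∑-cong (λ l → *-zeroʳ (f (suc l)))) (∑-zero n)) ⟩
  f zero +ℕ 0
    ≡⟨ +-identityʳ (f zero) ⟩
  f zero ∎
∑-δ {suc n} (suc j) f =
  trans (cong (_+ℕ ∑ n (λ l → f (suc l) * bit (toℕ j ≡ᵇ toℕ l))) (*-zeroʳ (f zero))) (∑-δ j (λ l → f (suc l)))

∑² : ∀ m n → (Fin m → Fin n → ℕ) → ℕ
∑² m n f = ∑ m λ i → ∑ n (f i)

∑²-cong : ∀ {m n} {f g : Fin m → Fin n → ℕ} → (∀ i j → f i j ≡ g i j) → ∑² m n f ≡ ∑² m n g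
∑²-cong f≗g = ∑-cong λ i → ∑-cong (f≗g i)

∑²-distrib-+ : ∀ {m n} (f g : Fin m → Fin n → ℕ) →
  ∑² m n (λ i j → f i j +ℕ g i j) ≡ ∑² m n f +ℕ ∑² m n g
∑²-distrib-+ {n = n} f g =
  trans (∑-cong λ i → ∑-distrib-+ (f i) (g i)) (∑-distrib-+ (λ i → ∑ n (f i)) (λ i → ∑ n (g i)))

∑⁴ : ∀ m n → (Fin m → Fin n → Fin m → Fin n → ℕ) → ℕ
∑⁴ m n f = ∑² m n λ i j → ∑² m n (f i j)

∑⁴-cong : ∀ {m n} {f g : Fin m → Fin n → Fin m → Fin n → ℕ} →
  (∀ i j k l → f i j k l ≡ g i j k l) → ∑⁴ m n f ≡ ∑⁴ m n g
∑⁴-cong f≗g = ∑²-cong λ i j → ∑²-cong (f≗g i j)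

∑⁴-distrib-+ : ∀ {m n} (f g : Fin m → Fin n → Fin m → Fin n → ℕ) →
  ∑⁴ m n (λ i j k l → f i j k l +ℕ g i j k l) ≡ ∑⁴ m n f +ℕ ∑⁴ m n g
∑⁴-distrib-+ {m} {n} f g =
  trans (∑²-cong λ i j → ∑²-distrib-+ (f i j) (g i j))
        (∑²-distrib-+ (λ i j → ∑² m n (f i j)) (λ i j → ∑² m n (g i j)))

bit-∧₃ : ∀ x y z → bit (x ∧ y ∧ z) ≡ bit x * (bit y * bit z)
bit-∧₃ true  true  true  = refl
bit-∧₃ true  true  false = refl
bit-∧₃ true  false z     = refl
bit-∧₃ false y     z     = refl

bit-∧₄ : ∀ x y z w → bit (x ∧ y ∧ z ∧ w) ≡ bit (x ∧ y ∧ z) * bit w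
bit-∧₄ true  true  true  true  = refl
bit-∧₄ true  true  true  false = refl
bit-∧₄ true  true  false w     = refl
bit-∧₄ true  false z     w     = refl
bit-∧₄ false y     z     w     = refl

bit-C2 : ∀ x → bit x C 2 ≡ 0
bit-C2 true  = refl
bit-C2 false = refl

bit-<ᵇ-trichotomy : ∀ a b → bit (b <ᵇ a) +ℕ bit (a <ᵇ b) +ℕ bit (a ≡ᵇ b) ≡ 1
bit-<ᵇ-trichotomy zero    zero    = refl
bit-<ᵇ-trichotomy zero    (suc b) = refl
bit-<ᵇ-trichotomy (suc a) zero    = refl
bit-<ᵇ-trichotomy (suc a) (suc b) = bit-<ᵇ-trichotomy a b

bit-∧-<ᵇ-trichotomy : ∀ x y z a b →
  bit (x ∧ y ∧ z ∧ (b <ᵇ a)) +ℕ bit (x ∧ y ∧ z ∧ (a <ᵇ b)) +ℕ bit (x ∧ y ∧ z ∧ (a ≡ᵇ b)) ≡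
  bit (x ∧ y ∧ z ∧ true)
bit-∧-<ᵇ-trichotomy true  true  true  a b = bit-<ᵇ-trichotomy a b
bit-∧-<ᵇ-trichotomy true  true  false a b = refl
bit-∧-<ᵇ-trichotomy true  false z     a b = refl
bit-∧-<ᵇ-trichotomy false y     z     a b = refl

<ᵇ-true : ∀ {a b} → a < b → (a <ᵇ b) ≡ true
<ᵇ-true {zero}  {suc b} _       = refl
<ᵇ-true {suc a} {suc b} (s≤s p) = <ᵇ-true p

<ᵇ-false : ∀ {a b} → b ≤ a → (a <ᵇ b) ≡ false
<ᵇ-false {a}     {zero}  _       = refl
<ᵇ-false {suc a} {suc b} (s≤s p) = <ᵇ-false p

∸-<ᵇ-reverse : ∀ k a b → a ≤ k → b ≤ k → (k ∸ a <ᵇ k ∸ b) ≡ (b <ᵇ a)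
∸-<ᵇ-reverse k       zero    zero    _       _       = <ᵇ-false (≤-refl {k})
∸-<ᵇ-reverse (suc k) zero    (suc b) _       _       = <ᵇ-false (m≤n⇒m≤1+n (m∸n≤m k b))
∸-<ᵇ-reverse (suc k) (suc a) zero    _       _       = <ᵇ-true (s≤s (m∸n≤m k a))
∸-<ᵇ-reverse (suc k) (suc a) (suc b) (s≤s p) (s≤s q) = ∸-<ᵇ-reverse k a b p q

opposite-<ᵇ : ∀ {n} (j l : Fin n) → (toℕ (opposite j) <ᵇ toℕ (opposite l)) ≡ (toℕ l <ᵇ toℕ j)
opposite-<ᵇ {suc n} j l =
  trans (cong₂ _<ᵇ_ (opposite-prop j) (opposite-prop l))
        (∸-<ᵇ-reverse n (toℕ j) (toℕ l) (toℕ≤pred[n] j) (toℕ≤pred[n] l))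

suc-C2 : ∀ a → suc a C 2 ≡ a +ℕ a C 2
suc-C2 a = trans (sym (nCk+nC[k+1]≡[n+1]C[k+1] a 1)) (cong (_+ℕ a C 2) (nC1≡n a))

+-C2 : ∀ a b → (a +ℕ b) C 2 ≡ a C 2 +ℕ b C 2 +ℕ a * b
+-C2 zero    b = sym (+-identityʳ (b C 2))
+-C2 (suc a) b = begin
  suc (a +ℕ b) C 2                       ≡⟨ suc-C2 (a +ℕ b) ⟩
  a +ℕ b +ℕ (a +ℕ b) C 2                 ≡⟨ cong (a +ℕ b +ℕ_) (+-C2 a b) ⟩
  a +ℕ b +ℕ (a C 2 +ℕ b C 2 +ℕ a * b)    ≡⟨ regroup a b (a C 2) (b C 2) ⟩
  a +ℕ a C 2 +ℕ b C 2 +ℕ suc a * b       ≡⟨ cong (λ t → t +ℕ b C 2 +ℕ suc a * b) (sym (suc-C2 a)) ⟩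
  suc a C 2 +ℕ b C 2 +ℕ suc a * b        ∎
  where
  regroup : ∀ a b x y → a +ℕ b +ℕ (x +ℕ y +ℕ a * b) ≡ a +ℕ x +ℕ y +ℕ suc a * b
  regroup = solve-∀

e₂ : ∀ n → (Fin n → ℕ) → ℕ
e₂ n x = ∑² n n λ i k → x i * (x k * bit (toℕ i <ᵇ toℕ k))

e₂-suc : ∀ n (x : Fin (suc n) → ℕ) →
  e₂ (suc n) x ≡ x zero * ∑ n (λ k → x (suc k)) +ℕ e₂ n (λ i → x (suc i))
e₂-suc n x = cong₂ _+ℕ_ firstRow (∑-cong λ i → cong (_+ℕ row i) (x*[x*0]≡0 (x (suc i))))
  where
  x*[x*0]≡0 : ∀ y → y * (x zero * 0) ≡ 0
  x*[x*0]≡0 y = trans (cong (y *_) (*-zeroʳ (x zero))) (*-zeroʳ y)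
  row : Fin n → ℕ
  row i = ∑ n λ k → x (suc i) * (x (suc k) * bit (toℕ i <ᵇ toℕ k))
  firstRow : x zero * (x zero * 0) +ℕ ∑ n (λ k → x zero * (x (suc k) * 1)) ≡ x zero * ∑ n (λ k → x (suc k))
  firstRow = begin
    x zero * (x zero * 0) +ℕ ∑ n (λ k → x zero * (x (suc k) * 1))
      ≡⟨ cong₂ _+ℕ_ (x*[x*0]≡0 (x zero)) (∑-cong λ k → cong (x zero *_) (*-identityʳ (x (suc k)))) ⟩
    ∑ n (λ k → x zero * x (suc k))
      ≡⟨ sym (*-distribˡ-∑ (x zero) (λ k → x (suc k))) ⟩
    x zero * ∑ n (λ k → x (suc k)) ∎

∑-C2 : ∀ n (x : Fin n → ℕ) → (∑ n x) C 2 ≡ ∑ n (λ i → x i C 2) +ℕ e₂ n x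
∑-C2 zero    x = refl
∑-C2 (suc n) x = begin
  (x₀ +ℕ s) C 2                                 ≡⟨ +-C2 x₀ s ⟩
  x₀ C 2 +ℕ s C 2 +ℕ x₀ * s                     ≡⟨ cong (λ t → x₀ C 2 +ℕ t +ℕ x₀ * s) (∑-C2 n x′) ⟩
  x₀ C 2 +ℕ (c +ℕ e₂ n x′) +ℕ x₀ * s            ≡⟨ regroup (x₀ C 2) c (e₂ n x′) (x₀ * s) ⟩
  x₀ C 2 +ℕ c +ℕ (x₀ * s +ℕ e₂ n x′)            ≡⟨ cong (x₀ C 2 +ℕ c +ℕ_) (sym (e₂-suc n x)) ⟩
  x₀ C 2 +ℕ c +ℕ e₂ (suc n) x                   ∎
  where
  x₀ = x zero
  x′ = λ i → x (suc i)
  s = ∑ n x′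
  c = ∑ n (λ i → x′ i C 2)
  regroup : ∀ a b d p → a +ℕ (b +ℕ d) +ℕ p ≡ a +ℕ b +ℕ (p +ℕ d)
  regroup = solve-∀

∑-bit-C2 : ∀ n (b : Fin n → Bool) → (∑ n (λ i → bit (b i))) C 2 ≡ e₂ n (λ i → bit (b i))
∑-bit-C2 n b =
  trans (∑-C2 n (λ i → bit (b i)))
        (cong (_+ℕ e₂ n (λ i → bit (b i))) (trans (∑-cong λ i → bit-C2 (b i)) (∑-zero n)))

∑⁴-opposite : ∀ {m n} (f : Fin m → Fin n → Fin m → Fin n → ℕ) →
  ∑⁴ m n f ≡ ∑⁴ m n (λ i j k l → f i (opposite j) k (opposite l))
∑⁴-opposite {m} {n} f = ∑-cong λ i →
  trans (∑-reverse (λ j → ∑² m n (f i j)))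
        (∑-cong λ j → ∑-cong λ k → ∑-reverse (f i (opposite j) k))

module _ {m n : ℕ} (A : Matrix01 m n) where

  pairTerm : (ℕ → ℕ → Bool) → Fin m → Fin n → Fin m → Fin n → ℕ
  pairTerm P i j k l = bit (A i j ∧ A k l ∧ (toℕ i <ᵇ toℕ k) ∧ P (toℕ j) (toℕ l))

  pairs : (ℕ → ℕ → Bool) → ℕ
  pairs P = ∑⁴ m n (pairTerm P)

  ν-conj≡pairs : ν (conj A) ≡ pairs _<ᵇ_
  ν-conj≡pairs = sym (trans (∑⁴-opposite (pairTerm _<ᵇ_)) (∑⁴-cong λ i j k l →
    cong (λ b → bit (A i (opposite j) ∧ A k (opposite l) ∧ (toℕ i <ᵇ toℕ k) ∧ b)) (opposite-<ᵇ j l)))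

  pairs-trichotomy : pairs (flip _<ᵇ_) +ℕ pairs _<ᵇ_ +ℕ pairs _≡ᵇ_ ≡ pairs (λ _ _ → true)
  pairs-trichotomy = begin
    pairs (flip _<ᵇ_) +ℕ pairs _<ᵇ_ +ℕ pairs _≡ᵇ_
      ≡⟨ cong (_+ℕ pairs _≡ᵇ_) (sym (∑⁴-distrib-+ (pairTerm (flip _<ᵇ_)) (pairTerm _<ᵇ_))) ⟩
    ∑⁴ m n (λ i j k l → pairTerm (flip _<ᵇ_) i j k l +ℕ pairTerm _<ᵇ_ i j k l) +ℕ pairs _≡ᵇ_
      ≡⟨ sym (∑⁴-distrib-+ _ (pairTerm _≡ᵇ_)) ⟩
    ∑⁴ m n (λ i j k l → pairTerm (flip _<ᵇ_) i j k l +ℕ pairTerm _<ᵇ_ i j k l +ℕ pairTerm _≡ᵇ_ i j k l)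
      ≡⟨ ∑⁴-cong (λ i j k l → bit-∧-<ᵇ-trichotomy (A i j) (A k l) (toℕ i <ᵇ toℕ k) (toℕ j) (toℕ l)) ⟩
    pairs (λ _ _ → true) ∎

  pairs-true≡e₂-rowSum : pairs (λ _ _ → true) ≡ e₂ m (rowSum A)
  pairs-true≡e₂-rowSum = sym (begin
    e₂ m (rowSum A)
      ≡⟨ ∑²-cong expand ⟩
    ∑² m m (λ i k → ∑² n n λ j l → bit (A i j) * (bit (A k l) * [ i < k ]))
      ≡⟨ ∑-cong (λ i → ∑-comm (λ k j → ∑ n λ l → bit (A i j) * (bit (A k l) * [ i < k ]))) ⟩
    ∑⁴ m n (λ i j k l → bit (A i j) * (bit (A k l) * [ i < k ]))
      ≡⟨ ∑⁴-cong (λ i j k l → sym (bit-∧-true (A i j) (A k l) (toℕ i <ᵇ toℕ k))) ⟩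
    pairs (λ _ _ → true) ∎)
    where
    [_<_] : Fin m → Fin m → ℕ
    [ i < k ] = bit (toℕ i <ᵇ toℕ k)
    expand : ∀ i k → rowSum A i * (rowSum A k * [ i < k ]) ≡ ∑² n n λ j l → bit (A i j) * (bit (A k l) * [ i < k ])
    expand i k = trans (cong (rowSum A i *_) (*-distribʳ-∑ [ i < k ] (λ l → bit (A k l))))
                       (∑-*-∑ (λ j → bit (A i j)) (λ l → bit (A k l) * [ i < k ]))
    bit-∧-true : ∀ x y z → bit (x ∧ y ∧ z ∧ true) ≡ bit x * (bit y * bit z)
    bit-∧-true x y z = trans (cong (λ w → bit (x ∧ y ∧ w)) (∧-identityʳ z)) (bit-∧₃ x y z)

  pairs-≡ᵇ≡∑-colSum-C2 : pairs _≡ᵇ_ ≡ ∑ n (λ j → colSum A j C 2)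
  pairs-≡ᵇ≡∑-colSum-C2 = begin
    pairs _≡ᵇ_
      ≡⟨ ∑-cong (λ i → ∑-cong λ j → ∑-cong λ k → sameColumn i j k) ⟩
    ∑ m (λ i → ∑ n λ j → ∑ m λ k → bit (A i j ∧ A k j ∧ (toℕ i <ᵇ toℕ k)))
      ≡⟨ ∑-comm (λ i j → ∑ m λ k → bit (A i j ∧ A k j ∧ (toℕ i <ᵇ toℕ k))) ⟩
    ∑ n (λ j → ∑ m λ i → ∑ m λ k → bit (A i j ∧ A k j ∧ (toℕ i <ᵇ toℕ k)))
      ≡⟨ ∑-cong (λ j → ∑-cong λ i → ∑-cong λ k → bit-∧₃ (A i j) (A k j) (toℕ i <ᵇ toℕ k)) ⟩
    ∑ n (λ j → e₂ m (λ i → bit (A i j)))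
      ≡⟨ ∑-cong (λ j → sym (∑-bit-C2 m (λ i → A i j))) ⟩
    ∑ n (λ j → colSum A j C 2) ∎
    where
    sameColumn : ∀ i j k → ∑ n (pairTerm _≡ᵇ_ i j k) ≡ bit (A i j ∧ A k j ∧ (toℕ i <ᵇ toℕ k))
    sameColumn i j k =
      trans (∑-cong λ l → bit-∧₄ (A i j) (A k l) (toℕ i <ᵇ toℕ k) (toℕ j ≡ᵇ toℕ l))
            (∑-δ j (λ l → bit (A i j ∧ A k l ∧ (toℕ i <ᵇ toℕ k))))

  ν+ν-conj+∑C2 :
    ν A +ℕ ν (conj A) +ℕ ∑ n (λ j → colSum A j C 2) +ℕ ∑ m (λ i → rowSum A i C 2) ≡ (∑ m (rowSum A)) C 2
  ν+ν-conj+∑C2 = begin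
    ν A +ℕ ν (conj A) +ℕ ∑ n (λ j → colSum A j C 2) +ℕ rowC
      ≡⟨⟩
    pairs (flip _<ᵇ_) +ℕ ν (conj A) +ℕ ∑ n (λ j → colSum A j C 2) +ℕ rowC
      ≡⟨ cong₂ (λ a b → pairs (flip _<ᵇ_) +ℕ a +ℕ b +ℕ rowC) ν-conj≡pairs (sym pairs-≡ᵇ≡∑-colSum-C2) ⟩
    pairs (flip _<ᵇ_) +ℕ pairs _<ᵇ_ +ℕ pairs _≡ᵇ_ +ℕ rowC
      ≡⟨ cong (_+ℕ rowC) (trans pairs-trichotomy pairs-true≡e₂-rowSum) ⟩
    e₂ m (rowSum A) +ℕ rowC
      ≡⟨ +-comm (e₂ m (rowSum A)) rowC ⟩
    rowC +ℕ e₂ m (rowSum A)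
      ≡⟨ sym (∑-C2 m (rowSum A)) ⟩
    (∑ m (rowSum A)) C 2 ∎
    where
    rowC = ∑ m (λ i → rowSum A i C 2)

+[m+n]-+n≡+m : ∀ a b → + (a +ℕ b) - + b ≡ + a
+[m+n]-+n≡+m a b = trans (ℤ.m-n≡m⊖n (a +ℕ b) b) (trans (ℤ.⊖-≥ (m≤n+m b a)) (cong +_ (m+n∸n≡m a b)))

lemma3 : (m n : ℕ) (R : Fin m → ℕ) (S : Fin n → ℕ) (A : Matrix01 m n) →
    InClass R S A →
    + (ν A +ℕ ν (conj A)) ≡
      (+ ((∑ m R) C 2) - + (∑ m (λ i → R i C 2))) - + (∑ n (λ j → S j C 2))
lemma3 m n R S A (rowSums , colSums) = begin
  + (ν A +ℕ ν (conj A))                                 ≡⟨ sym (+[m+n]-+n≡+m (ν A +ℕ ν (conj A)) ∑S) ⟩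
  + (ν A +ℕ ν (conj A) +ℕ ∑S) - + ∑S                    ≡⟨ cong (_- + ∑S) (sym (+[m+n]-+n≡+m _ ∑R)) ⟩
  (+ (ν A +ℕ ν (conj A) +ℕ ∑S +ℕ ∑R) - + ∑R) - + ∑S     ≡⟨ cong (λ t → (+ t - + ∑R) - + ∑S) counting ⟩
  (+ ((∑ m R) C 2) - + ∑R) - + ∑S                       ∎
  where
  ∑R = ∑ m (λ i → R i C 2)
  ∑S = ∑ n (λ j → S j C 2)
  counting : ν A +ℕ ν (conj A) +ℕ ∑S +ℕ ∑R ≡ (∑ m R) C 2
  counting = begin
    ν A +ℕ ν (conj A) +ℕ ∑S +ℕ ∑R
      ≡⟨ sym (cong₂ (λ s r → ν A +ℕ ν (conj A) +ℕ s +ℕ r)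
                    (∑-cong λ j → cong (_C 2) (colSums j)) (∑-cong λ i → cong (_C 2) (rowSums i))) ⟩
    ν A +ℕ ν (conj A) +ℕ ∑ n (λ j → colSum A j C 2) +ℕ ∑ m (λ i → rowSum A i C 2)
      ≡⟨ ν+ν-conj+∑C2 A ⟩
    (∑ m (rowSum A)) C 2
      ≡⟨ cong (_C 2) (∑-cong rowSums) ⟩
    (∑ m R) C 2 ∎
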